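{- Let $n\ge 1$ and let $H_A^+, H_U^+, H_W^+, H_C^+$ be four affine semispaces in $\mathbb{E}^n$ with unit normal vectors $A, U, W, C$, respectively. If $$(H_A^+\cap H_U^+)\setminus(H_W^+\cup H_C^+)\neq\emptyset \quad\text{and}\quad (H_W^+\cap H_C^+)\setminus(H_A^+\cup H_U^+)\neq\emptyset,$$ then $$\operatorname{pos}(A,U)\cap\operatorname{pos}(W,C)=\emptyset.$$
   Context: $\mathbb{E}^n$ denotes $n$-dimensional Euclidean space with inner product $x\cdot y$. An affine semispace with unit normal vector $N$ is an open half-space of the form $H_N^+=\{x\in\mathbb{E}^n : x\cdot N > c\}$ for some $c\in\mathbb{R}$, where $\|N\|=1$ (so $N$ points into the half-space). For vectors $v_1,\dots,v_k$, $\operatorname{pos}(v_1,\dots,v_k)=\{\lambda_1v_1+\dots+\lambda_kv_k : \lambda_1,\dots,\lambda_k>0\}$ denotes their positive span. -}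

module Defs where

open import Data.Nat using (ℕ; zero; suc)
open import Data.Fin using (Fin; zero; suc)
open import Data.Product using (Σ; ∃; _×_; _,_)
open import Data.Empty using (⊥)
open import Relation.Nullary using (¬_)
open import Relation.Binary.PropositionalEquality using (_≡_)
open import Relation.Binary.Definitions using (Trichotomous)

-- The real numbers, axiomatised as a complete ordered field.
-- (agda-stdlib has no reals; every model of this record is isomorphic to ℝ.)
record RealField : Set₁ where
  infixl 6 _+_
  infixl 7 _*_
  infix 4 _<_
  field
    Carrier : Set
    _+_ _*_ : Carrier → Carrier → Carrier
    -_      : Carrier → Carrier
    0# 1#   : Carrier
    _<_     : Carrier → Carrier → Set
    +-assoc   : ∀ x y z → (x + y) + z ≡ x + (y + z)
    +-comm    : ∀ x y → x + y ≡ y + x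
    +-identityˡ : ∀ x → 0# + x ≡ x
    -‿inverseˡ : ∀ x → (- x) + x ≡ 0#
    *-assoc   : ∀ x y z → (x * y) * z ≡ x * (y * z)
    *-comm    : ∀ x y → x * y ≡ y * x
    *-identityˡ : ∀ x → 1# * x ≡ x
    distribˡ  : ∀ x y z → x * (y + z) ≡ (x * y) + (x * z)
    0≢1       : ¬ (0# ≡ 1#)
    inverse   : ∀ x → ¬ (x ≡ 0#) → Σ Carrier (λ y → y * x ≡ 1#)
    <-irrefl  : ∀ x → ¬ (x < x)
    <-trans   : ∀ {x y z} → x < y → y < z → x < z
    <-tri     : Trichotomous _≡_ _<_
    +-mono-<  : ∀ {x y} z → x < y → x + z < y + z
    *-pos     : ∀ {x y} → 0# < x → 0# < y → 0# < x * y
  _≤_ : Carrier → Carrier → Set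
  x ≤ y = ¬ (y < x)
  field
    sup : (S : Carrier → Set) → (∃ λ x → S x) → (∃ λ b → ∀ x → S x → x ≤ b) →
          ∃ λ s → (∀ x → S x → x ≤ s) × (∀ b → (∀ x → S x → x ≤ b) → s ≤ b)

module Euclid (R : RealField) where
  open RealField R

  Vec : ℕ → Set
  Vec n = Fin n → Carrier

  _·_ : ∀ {n} → Vec n → Vec n → Carrier
  _·_ {zero}  x y = 0#
  _·_ {suc n} x y = (x zero * y zero) + ((λ i → x (suc i)) · (λ i → y (suc i)))

  -- ‖N‖ = 1  (equivalently N · N = 1, as norms are nonnegative)
  IsUnit : ∀ {n} → Vec n → Set
  IsUnit N = N · N ≡ 1#

  InSemispace : ∀ {n} → Vec n → Carrier → Vec n → Set
  InSemispace N c x = c < x · N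

  InPos2 : ∀ {n} → Vec n → Vec n → Vec n → Set
  InPos2 P Q v = ∃ λ l → ∃ λ m → (0# < l) × (0# < m) × (∀ i → v i ≡ (l * P i) + (m * Q i))

{-# OPTIONS --safe #-}
-- If v = λA + μU = ρW + σC with positive coefficients, evaluate the linear form
-- z ↦ z · v at the two witnesses x and y.  The point y lies on the positive side
-- of the W- and C-hyperplanes and x does not, so y · W > x · W and y · C > x · C,
-- whence y · v > x · v; symmetrically A and U give x · v > y · v.
module Submission where

open import Defs
open import Data.Nat using (ℕ; _≥_; zero; suc)
open import Data.Fin using (zero; suc)
open import Data.Product using (∃; _×_; _,_)
open import Data.Empty using (⊥; ⊥-elim)
open import Relation.Nullary using (¬_)
open import Relation.Binary.PropositionalEquality
open import Relation.Binary.Definitions using (tri<; tri≈; tri>)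

module Properties (R : RealField) where
  open RealField R
  open Euclid R
  open ≡-Reasoning

  +-identityʳ : ∀ x → x + 0# ≡ x
  +-identityʳ x = trans (+-comm x 0#) (+-identityˡ x)

  -‿inverseʳ : ∀ x → x + (- x) ≡ 0#
  -‿inverseʳ x = trans (+-comm x (- x)) (-‿inverseˡ x)

  +-cancelʳ : ∀ {x y} z → x + z ≡ y + z → x ≡ y
  +-cancelʳ {x} {y} z eq = begin
    x                 ≡⟨ sym (+-identityʳ x) ⟩
    x + 0#            ≡⟨ cong (x +_) (sym (-‿inverseʳ z)) ⟩
    x + (z + - z)     ≡⟨ sym (+-assoc x z (- z)) ⟩
    (x + z) + - z     ≡⟨ cong (_+ - z) eq ⟩
    (y + z) + - z     ≡⟨ +-assoc y z (- z) ⟩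
    y + (z + - z)     ≡⟨ cong (y +_) (-‿inverseʳ z) ⟩
    y + 0#            ≡⟨ +-identityʳ y ⟩
    y                 ∎

  +-interchange : ∀ a b c d → (a + b) + (c + d) ≡ (a + c) + (b + d)
  +-interchange a b c d = begin
    (a + b) + (c + d) ≡⟨ +-assoc a b (c + d) ⟩
    a + (b + (c + d)) ≡⟨ cong (a +_) (sym (+-assoc b c d)) ⟩
    a + ((b + c) + d) ≡⟨ cong (λ t → a + (t + d)) (+-comm b c) ⟩
    a + ((c + b) + d) ≡⟨ cong (a +_) (+-assoc c b d) ⟩
    a + (c + (b + d)) ≡⟨ sym (+-assoc a c (b + d)) ⟩
    (a + c) + (b + d) ∎

  *-zeroʳ : ∀ x → x * 0# ≡ 0#
  *-zeroʳ x = +-cancelʳ (x * 0#) (begin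
    x * 0# + x * 0#   ≡⟨ sym (distribˡ x 0# 0#) ⟩
    x * (0# + 0#)     ≡⟨ cong (x *_) (+-identityˡ 0#) ⟩
    x * 0#            ≡⟨ sym (+-identityˡ _) ⟩
    0# + x * 0#       ∎)

  *-left-commute : ∀ x y z → x * (y * z) ≡ y * (x * z)
  *-left-commute x y z = begin
    x * (y * z)       ≡⟨ sym (*-assoc x y z) ⟩
    (x * y) * z       ≡⟨ cong (_* z) (*-comm x y) ⟩
    (y * x) * z       ≡⟨ *-assoc y x z ⟩
    y * (x * z)       ∎

  x<y⇒0<y-x : ∀ {x y} → x < y → 0# < y + - x
  x<y⇒0<y-x {x} {y} x<y = subst (_< y + - x) (-‿inverseʳ x) (+-mono-< (- x) x<y)

  *-monoˡ-< : ∀ {l x y} → 0# < l → x < y → l * x < l * y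
  *-monoˡ-< {l} {x} {y} 0<l x<y =
    subst₂ _<_ (+-identityˡ (l * x)) shift (+-mono-< (l * x) (*-pos 0<l (x<y⇒0<y-x x<y)))
    where
    shift : l * (y + - x) + l * x ≡ l * y
    shift = begin
      l * (y + - x) + l * x     ≡⟨ sym (distribˡ l (y + - x) x) ⟩
      l * ((y + - x) + x)       ≡⟨ cong (l *_) (+-assoc y (- x) x) ⟩
      l * (y + (- x + x))       ≡⟨ cong (λ t → l * (y + t)) (-‿inverseˡ x) ⟩
      l * (y + 0#)              ≡⟨ cong (l *_) (+-identityʳ y) ⟩
      l * y                     ∎

  +-mono-<-< : ∀ {a b c d} → a < b → c < d → a + c < b + d
  +-mono-<-< {a} {b} {c} {d} a<b c<d = <-trans (+-mono-< c a<b)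
    (subst₂ _<_ (+-comm c b) (+-comm d b) (+-mono-< b c<d))

  ≤-<-trans : ∀ {x y z} → x ≤ y → y < z → x < z
  ≤-<-trans {x} {y} {z} x≤y y<z with <-tri y x
  ... | tri< y<x _ _ = ⊥-elim (x≤y y<x)
  ... | tri≈ _ y≡x _ = subst (_< z) y≡x y<z
  ... | tri> _ _ x<y = <-trans x<y y<z

  ·-linearʳ : ∀ {n} (x v P Q : Vec n) l m → (∀ i → v i ≡ l * P i + m * Q i) →
              x · v ≡ l * (x · P) + m * (x · Q)
  ·-linearʳ {zero} x v P Q l m _ = sym (begin
    l * 0# + m * 0#   ≡⟨ cong₂ _+_ (*-zeroʳ l) (*-zeroʳ m) ⟩
    0# + 0#           ≡⟨ +-identityˡ 0# ⟩
    0#                ∎)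
  ·-linearʳ {suc n} x v P Q l m v≡ = begin
    x₀ * v zero + (x' · v')
      ≡⟨ cong₂ _+_ (cong (x₀ *_) (v≡ zero)) (·-linearʳ x' v' P' Q' l m (λ i → v≡ (suc i))) ⟩
    x₀ * (l * P zero + m * Q zero) + (l * (x' · P') + m * (x' · Q'))
      ≡⟨ cong (_+ (l * (x' · P') + m * (x' · Q'))) (distribˡ x₀ _ _) ⟩
    (x₀ * (l * P zero) + x₀ * (m * Q zero)) + (l * (x' · P') + m * (x' · Q'))
      ≡⟨ cong₂ (λ s t → (s + t) + (l * (x' · P') + m * (x' · Q')))
           (*-left-commute x₀ l (P zero)) (*-left-commute x₀ m (Q zero)) ⟩
    (l * (x₀ * P zero) + m * (x₀ * Q zero)) + (l * (x' · P') + m * (x' · Q'))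
      ≡⟨ +-interchange _ _ _ _ ⟩
    (l * (x₀ * P zero) + l * (x' · P')) + (m * (x₀ * Q zero) + m * (x' · Q'))
      ≡⟨ cong₂ _+_ (sym (distribˡ l _ _)) (sym (distribˡ m _ _)) ⟩
    l * (x₀ * P zero + (x' · P')) + m * (x₀ * Q zero + (x' · Q')) ∎
    where
    x₀ = x zero
    x' = λ i → x (suc i)
    v' = λ i → v (suc i)
    P' = λ i → P (suc i)
    Q' = λ i → Q (suc i)

  InPos2⇒·-mono-< : ∀ {n} (x y P Q v : Vec n) →
                    x · P < y · P → x · Q < y · Q → InPos2 P Q v → x · v < y · v
  InPos2⇒·-mono-< x y P Q v xP<yP xQ<yQ (l , m , 0<l , 0<m , v≡) =
    subst₂ _<_ (sym (·-linearʳ x v P Q l m v≡)) (sym (·-linearʳ y v P Q l m v≡))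
      (+-mono-<-< (*-monoˡ-< 0<l xP<yP) (*-monoˡ-< 0<m xQ<yQ))

  InSemispace-separates : ∀ {n} (N x y : Vec n) {c} →
                          InSemispace N c y → ¬ InSemispace N c x → x · N < y · N
  InSemispace-separates _ _ _ c<y·N x·N≤c = ≤-<-trans x·N≤c c<y·N

mainTheorem1 : (R : RealField) → (n : ℕ) → n ≥ 1 →
    (A U W C : Euclid.Vec R n) →
    Euclid.IsUnit R A → Euclid.IsUnit R U → Euclid.IsUnit R W → Euclid.IsUnit R C →
    (a u w c : RealField.Carrier R) →
    (∃ λ x → Euclid.InSemispace R A a x × Euclid.InSemispace R U u x
           × ¬ Euclid.InSemispace R W w x × ¬ Euclid.InSemispace R C c x) →
    (∃ λ y → Euclid.InSemispace R W w y × Euclid.InSemispace R C c y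
           × ¬ Euclid.InSemispace R A a y × ¬ Euclid.InSemispace R U u y) →
    (v : Euclid.Vec R n) → Euclid.InPos2 R A U v → Euclid.InPos2 R W C v → ⊥
mainTheorem1 R _ _ A U W C _ _ _ _ _ _ _ _
  (x , x∈A , x∈U , x∉W , x∉C) (y , y∈W , y∈C , y∉A , y∉U) v v∈pos[A,U] v∈pos[W,C] =
  <-irrefl (x · v) (<-trans x·v<y·v y·v<x·v)
  where
  open RealField R
  open Euclid R
  open Properties R

  x·v<y·v : x · v < y · v
  x·v<y·v = InPos2⇒·-mono-< x y W C v (InSemispace-separates W x y y∈W x∉W)
                                      (InSemispace-separates C x y y∈C x∉C) v∈pos[W,C]

  y·v<x·v : y · v < x · v
  y·v<x·v = InPos2⇒·-mono-< y x A U v (InSemispace-separates A y x x∈A y∉A)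
                                      (InSemispace-separates U y x x∈U y∉U) v∈pos[A,U]
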